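{- The calculus PC$\pm$ is sound with respect to $\vDash_{PC\pm}$: every formula of $\mathcal{L}_{PC\pm}$ derivable in PC$\pm$ is true at every world of every conditional neighbourhood model under $\vDash_{PC\pm}$.
   Context: Fix a set $P$ of proposition letters and a finite set $Ag$ of agents. The language $\mathcal{L}_{PC\pm}$ is $\phi::=\top\mid p\mid\neg\phi\mid(\phi\wedge\phi)\mid B_a(\phi,\phi)\mid[\pm\phi]\phi$ ($p\in P$, $a\in Ag$); $\bot,\vee,\to,\leftrightarrow$ as usual, $K_a\phi:=\neg B_a(\neg\phi,\top)$, $\check K_a\phi:=\neg K_a\neg\phi$. A conditional neighbourhood model is $\mathfrak{M}=(W,N,V)$: $W$ non-empty, $V:P\to\mathcal{P}(W)$, and $N$ assigns to each $a\in Ag$, $w\in W$, $X\subseteq W$ a set $N_a^w(X)\subseteq\mathcal{P}(W)$ such that, writing $[w]_a=\{v\mid\forall X\subseteq W,\ N_a^w(X)=N_a^v(X)\}$ (the class of $w$ under the induced equivalence $\sim_a$): (c) each $Y\in N_a^w(X)$ has $Y\subseteq X\cap[w]_a$; (ec) if $X\cap[w]_a=Y\cap[w]_a$ then $N_a^w(X)=N_a^w(Y)$; (d) for $Y\in N_a^w(X)$, $(X\cap[w]_a)\setminus Y\notin N_a^w(X)$; (sc) for $Y,Z\subseteq X\cap[w]_a$, if $(X\cap[w]_a)\setminus Y\notin N_a^w(X)$ and $Y\subsetneq Z$ then $Z\in N_a^w(X)$. Semantics $\vDash_{PC\pm}$: $\top$ always true; $p$ iff $w\in V(p)$; Booleans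 as usual; $\mathfrak{M},w\vDash B_a(\phi,\psi)$ iff some $Y\in N_a^w(\llbracket\phi\rrbracket_{\mathfrak{M}})$ has $Y\subseteq\llbracket\psi\rrbracket_{\mathfrak{M}}$ (with $\llbracket\phi\rrbracket_{\mathfrak{M}}=\{v\mid\mathfrak{M},v\vDash\phi\}$); $\mathfrak{M},w\vDash[\pm\phi]\psi$ iff $\mathfrak{M}^{\pm\phi},w\vDash\psi$. The update $\mathfrak{M}^{\pm\phi}=(W,{}^{\pm\phi}N,V)$: let $w\sim_a^{\pm\phi}v$ iff $w\sim_a v$ and ($\mathfrak{M},w\vDash\phi$ iff $\mathfrak{M},v\vDash\phi$), with classes $[w]_a^{\pm\phi}$, and put ${}^{\pm\phi}N_a^w(X)=N_a^w(X\cap[w]_a^{\pm\phi})$. The calculus PC$\pm$ consists of the CN calculus over $\mathcal{L}_{PC\pm}$ — axioms (Taut) propositional tautologies; (Dist-K) $K_a(\phi\to\psi)\to K_a\phi\to K_a\psi$; (T) $K_a\phi\to\phi$; (5B) $B_a(\phi,\psi)\to K_aB_a(\phi,\psi)$; (4B) $\neg B_a(\phi,\psi)\to K_a\neg B_a(\phi,\psi)$; (D) $B_a(\phi,\psi)\to\neg B_a(\phi,\neg\psi)$; (EC) $K_a(\phi\leftrightarrow\psi)\to B_a(\phi,\chi)\to B_a(\psi,\chi)$; (M) $K_a(\phi\to\psi)\to B_a(\chi,\phi)\to B_a(\chi,\psi)$; (C) $B_a(\phi,\psi)\to B_a(\phi,\phi\wedge\psi)$; (SC) $\neg B_a(\chi,\neg\phi)\wedge\check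 K_a(\chi\wedge\neg\phi\wedge\psi)\to B_a(\chi,\phi\vee\psi)$; rules Modus Ponens and from $\phi$ infer $K_a\phi$ — plus the reduction axioms $[\pm\phi]p\leftrightarrow p$, $[\pm\phi]\neg\psi\leftrightarrow\neg[\pm\phi]\psi$, $[\pm\phi](\psi\wedge\chi)\leftrightarrow([\pm\phi]\psi\wedge[\pm\phi]\chi)$, and $[\pm\phi]B_a(\psi,\chi)\leftrightarrow(\phi\to B_a(\phi\wedge[\pm\phi]\psi,[\pm\phi]\chi))\wedge(\neg\phi\to B_a(\neg\phi\wedge[\pm\phi]\psi,[\pm\phi]\chi))$. -}

module Defs where

open import Level using (0ℓ)
open import Data.Bool using (Bool; true; false; not; _∧_; T)
open import Data.Bool.Properties using () renaming (_≟_ to _≟ᵇ_)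
open import Data.Product using (Σ; _×_; _,_)
open import Relation.Nullary using (¬_; Dec; does)
open import Relation.Binary.PropositionalEquality using (_≡_)
open import Axiom.ExcludedMiddle using (ExcludedMiddle)

infixr 6 _∧'_

data Form (P Ag : Set) : Set where
  ⊤'    : Form P Ag
  var   : P → Form P Ag
  ¬'_   : Form P Ag → Form P Ag
  _∧'_  : Form P Ag → Form P Ag → Form P Ag
  B     : Ag → Form P Ag → Form P Ag → Form P Ag
  [±_]_ : Form P Ag → Form P Ag → Form P Ag

module _ {P Ag : Set} where

  infixr 5 _∨'_
  infixr 4 _⇒_
  infixr 3 _⇔'_

  ⊥' : Form P Ag
  ⊥' = ¬' ⊤'

  _∨'_ : Form P Ag → Form P Ag → Form P Ag
  φ ∨' ψ = ¬' ((¬' φ) ∧' (¬' ψ))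

  _⇒_ : Form P Ag → Form P Ag → Form P Ag
  φ ⇒ ψ = ¬' (φ ∧' (¬' ψ))

  _⇔'_ : Form P Ag → Form P Ag → Form P Ag
  φ ⇔' ψ = (φ ⇒ ψ) ∧' (ψ ⇒ φ)

  K : Ag → Form P Ag → Form P Ag
  K a φ = ¬' B a (¬' φ) ⊤'

  K̂ : Ag → Form P Ag → Form P Ag
  K̂ a φ = ¬' K a (¬' φ)

  -- Propositional tautologies (instances): true under every Boolean
  -- valuation of the non-Boolean (maximal) subformulas.

  beval : (Form P Ag → Bool) → Form P Ag → Bool
  beval v ⊤'        = true
  beval v (¬' φ)    = not (beval v φ)
  beval v (φ ∧' ψ)  = beval v φ ∧ beval v ψ
  beval v φ@(var _)     = v φ
  beval v φ@(B _ _ _)   = v φ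
  beval v φ@([± _ ] _)  = v φ

  Taut : Form P Ag → Set
  Taut φ = ∀ (v : Form P Ag → Bool) → beval v φ ≡ true

  infix 2 ⊢_
  data ⊢_ : Form P Ag → Set where
    taut   : ∀ {φ} → Taut φ → ⊢ φ
    distK  : ∀ {a φ ψ} → ⊢ K a (φ ⇒ ψ) ⇒ K a φ ⇒ K a ψ
    axT    : ∀ {a φ} → ⊢ K a φ ⇒ φ
    ax5B   : ∀ {a φ ψ} → ⊢ B a φ ψ ⇒ K a (B a φ ψ)
    ax4B   : ∀ {a φ ψ} → ⊢ (¬' B a φ ψ) ⇒ K a (¬' B a φ ψ)
    axD    : ∀ {a φ ψ} → ⊢ B a φ ψ ⇒ ¬' B a φ (¬' ψ)
    axEC   : ∀ {a φ ψ χ} → ⊢ K a (φ ⇔' ψ) ⇒ B a φ χ ⇒ B a ψ χ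
    axM    : ∀ {a φ ψ χ} → ⊢ K a (φ ⇒ ψ) ⇒ B a χ φ ⇒ B a χ ψ
    axC    : ∀ {a φ ψ} → ⊢ B a φ ψ ⇒ B a φ (φ ∧' ψ)
    axSC   : ∀ {a φ ψ χ} →
             ⊢ ((¬' B a χ (¬' φ)) ∧' K̂ a (χ ∧' ((¬' φ) ∧' ψ))) ⇒ B a χ (φ ∨' ψ)
    redP   : ∀ {φ p} → ⊢ ([± φ ] var p) ⇔' var p
    redNeg : ∀ {φ ψ} → ⊢ ([± φ ] (¬' ψ)) ⇔' ¬' ([± φ ] ψ)
    redAnd : ∀ {φ ψ χ} → ⊢ ([± φ ] (ψ ∧' χ)) ⇔' (([± φ ] ψ) ∧' ([± φ ] χ))
    redB   : ∀ {a φ ψ χ} →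
             ⊢ ([± φ ] B a ψ χ) ⇔'
               ((φ ⇒ B a (φ ∧' ([± φ ] ψ)) ([± φ ] χ))
                 ∧' ((¬' φ) ⇒ B a ((¬' φ) ∧' ([± φ ] ψ)) ([± φ ] χ)))
    mp     : ∀ {φ ψ} → ⊢ φ ⇒ ψ → ⊢ φ → ⊢ ψ
    nec    : ∀ {a φ} → ⊢ φ → ⊢ K a φ

Subset : Set → Set
Subset W = W → Bool

module _ {W : Set} where

  _∈_ : W → Subset W → Set
  v ∈ X = T (X v)

  _≐_ : Subset W → Subset W → Set
  X ≐ Y = ∀ v → X v ≡ Y v

  _⊆_ : Subset W → Subset W → Set
  X ⊆ Y = ∀ v → v ∈ X → v ∈ Y

  _⊊_ : Subset W → Subset W → Set
  Y ⊊ Z = (Y ⊆ Z) × ¬ (Y ≐ Z)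

-- Neighbourhood functions: N a w X Y  means  Y ∈ N_a^w(X)
NbhdFn : Set → Set → Set₁
NbhdFn Ag W = Ag → W → Subset W → Subset W → Set

module _ {Ag W : Set} (N : NbhdFn Ag W) where

  Sim : Ag → W → W → Set
  Sim a w v = ∀ (X Y : Subset W) → (N a w X Y → N a v X Y) × (N a v X Y → N a w X Y)

  ⊆Cls : Ag → W → Subset W → Subset W → Set
  ⊆Cls a w X Y = ∀ v → v ∈ Y → (v ∈ X) × Sim a w v

  IsRelDiff : Ag → W → Subset W → Subset W → Subset W → Set
  IsRelDiff a w X Y C = ∀ v →
    (v ∈ C → (v ∈ X) × Sim a w v × ¬ (v ∈ Y)) ×
    ((v ∈ X) × Sim a w v × ¬ (v ∈ Y) → v ∈ C)

  record IsCN : Set₁ where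
    field
      -- N_a^w(X) is a set of subsets: it respects extensional equality
      ext : ∀ {a w X X' Y Y'} → X ≐ X' → Y ≐ Y' → N a w X Y → N a w X' Y'
      c   : ∀ {a w X Y} → N a w X Y → ⊆Cls a w X Y
      ec  : ∀ {a w X Y} → (∀ v → Sim a w v → X v ≡ Y v) →
            ∀ Z → (N a w X Z → N a w Y Z) × (N a w Y Z → N a w X Z)
      d   : ∀ {a w X Y} → N a w X Y → ∀ C → IsRelDiff a w X Y C → ¬ N a w X C
      sc  : ∀ {a w X Y Z} → ⊆Cls a w X Y → ⊆Cls a w X Z →
            (∀ C → IsRelDiff a w X Y C → ¬ N a w X C) →
            Y ⊊ Z → N a w X Z

record CNModel (P Ag : Set) : Set₁ where
  field
    W    : Set
    w₀   : W
    N    : NbhdFn Ag W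
    V    : P → Subset W
    isCN : IsCN N

-- Semantics ⊨_{PC±}.  The metatheory is classical; an excluded-middle
-- oracle is used to turn propositions into Booleans (truth sets).

module Semantics (em : ExcludedMiddle 0ℓ) {P Ag W : Set} (V : P → Subset W) where

  upd : NbhdFn Ag W → Subset W → NbhdFn Ag W
  upd N Tφ a w X Y =
    N a w (λ v → X v ∧ (does (em {Sim N a w v}) ∧ does (Tφ w ≟ᵇ Tφ v))) Y

  sat : NbhdFn Ag W → Form P Ag → Subset W
  sat N ⊤'          w = true
  sat N (var p)     w = V p w
  sat N (¬' φ)      w = not (sat N φ w)
  sat N (φ ∧' ψ)    w = sat N φ w ∧ sat N ψ w
  sat N (B a φ ψ)   w =
    does (em {Σ (Subset W) λ Y → N a w (sat N φ) Y × (Y ⊆ sat N ψ)})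
  sat N ([± φ ] ψ)  w = sat (upd N (sat N φ)) ψ w

_,_⊨⟨_⟩_ : {P Ag : Set} (M : CNModel P Ag) → CNModel.W M →
           ExcludedMiddle 0ℓ → Form P Ag → Set
M , w ⊨⟨ em ⟩ φ = Semantics.sat em (CNModel.V M) (CNModel.N M) φ w ≡ true

-- Two facts about a CN
-- neighbourhood function carry the epistemic axioms: N_a^w(X) is inhabited
-- exactly when X meets [w]_a, which makes K_a the box of ∼_a, and N_a^w(X) is
-- upward closed inside X ∩ [w]_a; both come from (d) and (sc).  The reduction
-- axiom for B holds because on [w]_a the refined cell [w]_a^{±φ} is cut out by
-- φ or by ¬φ, according to whether w satisfies φ, so (ec) identifies the
-- neighbourhoods before and after the update.
module Submission where

open import Defs
open import Level using (0ℓ)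
open import Data.Nat using (ℕ)
open import Data.Fin using (Fin)
open import Axiom.ExcludedMiddle using (ExcludedMiddle)
open import Data.Bool using (true; false; not; _∧_; T)
open import Data.Bool.Properties using (T-∧; T-≡; ∧-comm) renaming (_≟_ to _≟ᵇ_)
open import Data.Unit using (tt)
open import Data.Empty using (⊥-elim)
open import Data.Product using (Σ; _×_; _,_; proj₁; proj₂)
open import Data.Sum using (_⊎_; inj₁; inj₂)
open import Function using (id; _∘_)
open import Function.Bundles using (_⇔_; mk⇔; Equivalence)
open import Relation.Nullary using (¬_; Dec; yes; no; does)
open import Relation.Nullary.Decidable using (dec-true; does-⇔; decidable-stable; T?)
open import Relation.Binary.PropositionalEquality
  using (_≡_; refl; sym; trans; cong; cong₂; subst; module ≡-Reasoning)

open Equivalence using (to; from)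

T-does : ∀ {A : Set} (a? : Dec A) → T (does a?) ⇔ A
T-does (yes a) = mk⇔ (λ _ → a) (λ _ → tt)
T-does (no ¬a) = mk⇔ (λ ()) ¬a

T-not : ∀ {x} → T (not x) ⇔ (¬ T x)
T-not {true}  = mk⇔ (λ ()) (λ ¬t → ¬t tt)
T-not {false} = mk⇔ (λ _ ()) (λ _ → tt)

T-⇒ : ∀ {x y} → T (not (x ∧ not y)) ⇔ (T x → T y)
T-⇒ {true}  {true}  = mk⇔ (λ _ _ → tt) (λ _ → tt)
T-⇒ {true}  {false} = mk⇔ (λ ()) (λ f → f tt)
T-⇒ {false}         = mk⇔ (λ _ ()) (λ _ → tt)

T-⇔ : ∀ {x y} → T (not (x ∧ not y) ∧ not (y ∧ not x)) ⇔ (x ≡ y)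
T-⇔ {true}  {true}  = mk⇔ (λ _ → refl) (λ _ → tt)
T-⇔ {true}  {false} = mk⇔ (λ ()) (λ ())
T-⇔ {false} {true}  = mk⇔ (λ ()) (λ ())
T-⇔ {false} {false} = mk⇔ (λ _ → refl) (λ _ → tt)

T-∨⁺ : ∀ {x y} → T x ⊎ T y → T (not (not x ∧ not y))
T-∨⁺ {true}          _ = tt
T-∨⁺ {false} {true}  _ = tt
T-∨⁺ {false} {false} (inj₁ ())
T-∨⁺ {false} {false} (inj₂ ())

T-injective : ∀ {x y} → T x ⇔ T y → x ≡ y
T-injective {true}  {true}  _   = refl
T-injective {true}  {false} x⇔y = ⊥-elim (to x⇔y tt)
T-injective {false} {true}  x⇔y = ⊥-elim (from x⇔y tt)
T-injective {false} {false} _   = refl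

≟-from-true : ∀ {b} → T b → ∀ t → t ≡ does (b ≟ᵇ t)
≟-from-true {true} _ true  = refl
≟-from-true {true} _ false = refl

≟-from-false : ∀ {b} → ¬ T b → ∀ t → not t ≡ does (b ≟ᵇ t)
≟-from-false {true}  ¬b    = ⊥-elim (¬b tt)
≟-from-false {false} _ true  = refl
≟-from-false {false} _ false = refl

≡-by-cases : ∀ t l b₁ b₂ → (T t → l ≡ b₁) → (¬ T t → l ≡ b₂) →
             l ≡ not (t ∧ not b₁) ∧ not (not t ∧ not b₂)
≡-by-cases true  l true  b₂    f g = f tt
≡-by-cases true  l false b₂    f g = f tt
≡-by-cases false l b₁    true  f g = g λ ()
≡-by-cases false l b₁    false f g = g λ ()

module _ {W : Set} where

  ∅ : Subset W
  ∅ _ = false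

  ∁ : Subset W → Subset W
  ∁ X v = not (X v)

  _∩_ : Subset W → Subset W → Subset W
  (X ∩ Y) v = X v ∧ Y v

module NeighbourhoodProperties
  (em : ExcludedMiddle 0ℓ) {Ag W : Set} {N : NbhdFn Ag W} (isCN : IsCN N) where

  open IsCN isCN

  Sim-refl : ∀ {a w} → Sim N a w w
  Sim-refl X Y = id , id

  restrict : Ag → W → Subset W → Subset W
  restrict a w X v = X v ∧ does (em {Sim N a w v})

  ∈-restrict⁺ : ∀ {a w X v} → v ∈ X → Sim N a w v → v ∈ restrict a w X
  ∈-restrict⁺ x s = from T-∧ (x , from (T-does em) s)

  ∈-restrict⁻ : ∀ {a w X v} → v ∈ restrict a w X → (v ∈ X) × Sim N a w v
  ∈-restrict⁻ {X = X} {v} t with to (T-∧ {X v}) t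
  ... | x , s = x , to (T-does em) s

  restrict-∩-⊆Cls : ∀ {a w X H} → ⊆Cls N a w X (restrict a w X ∩ H)
  restrict-∩-⊆Cls {X = X} v t = ∈-restrict⁻ {X = X} (proj₁ (to T-∧ t))

  N-upward : ∀ {a w X Y Z} → N a w X Y → Y ⊆ Z → ⊆Cls N a w X Z → N a w X Z
  N-upward {Y = Y} {Z} n Y⊆Z Z⊆X with em {Y ≐ Z}
  ... | yes Y≐Z = ext (λ _ → refl) Y≐Z n
  ... | no  Y≉Z = sc (c n) Z⊆X (d n) (Y⊆Z , Y≉Z)

  -- If the class is not a neighbourhood, (sc) applied to ∅ ⊊ X ∩ [w]_a makes it one.
  restrict-∈-N : ∀ {a w X v} → Sim N a w v → v ∈ X → N a w X (restrict a w X)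
  restrict-∈-N {a} {w} {X} {v} s x with em {N a w X (restrict a w X)}
  ... | yes n = n
  ... | no ¬n = sc (λ _ ()) ⊆Cls-restrict noComplement (∅⊆ , ∅≉)
    where
      ⊆Cls-restrict : ⊆Cls N a w X (restrict a w X)
      ⊆Cls-restrict u = ∈-restrict⁻ {X = X}
      ∅⊆ : ∅ ⊆ restrict a w X
      ∅⊆ _ ()
      ∅≉ : ¬ (∅ ≐ restrict a w X)
      ∅≉ eq = subst T (sym (eq v)) (∈-restrict⁺ {X = X} x s)
      noComplement : ∀ C → IsRelDiff N a w X ∅ C → ¬ N a w X C
      noComplement C rd = ¬n ∘ ext (λ _ → refl) C≐
        where
          C≐ : C ≐ restrict a w X
          C≐ u = T-injective (mk⇔
            (λ t → let x , s , _ = proj₁ (rd u) t in ∈-restrict⁺ {X = X} x s)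
            (λ t → let x , s = ∈-restrict⁻ {X = X} t in proj₂ (rd u) (x , s , λ ())))

  N-domain-inhabited : ∀ {a w X Y} → N a w X Y → Σ W λ v → Sim N a w v × v ∈ X
  N-domain-inhabited {a} {w} {X} {Y} n with em {Σ W λ v → Sim N a w v × v ∈ X}
  ... | yes p = p
  ... | no ¬p = ⊥-elim (d n ∅ ∅-relDiff (ext (λ _ → refl) Y≐∅ n))
    where
      Y≐∅ : Y ≐ ∅
      Y≐∅ u = T-injective (mk⇔ (λ y → let x , s = c n u y in ¬p (u , s , x)) λ ())
      ∅-relDiff : IsRelDiff N a w X Y ∅
      ∅-relDiff u = (λ ()) , λ (x , s , _) → ¬p (u , s , x)

  restrict-∖-IsRelDiff : ∀ {a w X Y} → IsRelDiff N a w X Y (restrict a w X ∩ ∁ Y)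
  restrict-∖-IsRelDiff {X = X} {Y} u =
    (λ t → let r , ¬y = to T-∧ t ; x , s = ∈-restrict⁻ {X = X} r in x , s , to T-not ¬y) ,
    (λ (x , s , ¬y) → from T-∧ (∈-restrict⁺ {X = X} x s , from T-not ¬y))

  N-intersecting : ∀ {a w X Y Y′} → N a w X Y → N a w X Y′ → ¬ (∀ v → v ∈ Y → ¬ v ∈ Y′)
  N-intersecting {a} {w} {X} {Y} {Y′} n n′ disjoint =
    d n (restrict a w X ∩ ∁ Y) restrict-∖-IsRelDiff
      (N-upward n′ Y′⊆C (restrict-∩-⊆Cls {X = X}))
    where
      Y′⊆C : Y′ ⊆ (restrict a w X ∩ ∁ Y)
      Y′⊆C u y′ = let x , s = c n′ u y′ in
        from T-∧ (∈-restrict⁺ {X = X} x s , from T-not λ y → disjoint u y y′)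

  restrict-∩-∈-N : ∀ {a w X F H v} → (∀ Y → N a w X Y → ¬ (Y ⊆ ∁ F)) →
                   Sim N a w v → v ∈ X → ¬ v ∈ F → v ∈ H → F ⊆ H →
                   N a w X (restrict a w X ∩ H)
  restrict-∩-∈-N {a} {w} {X} {F} {H} {v} noNbhd s x ¬f h F⊆H =
    sc (restrict-∩-⊆Cls {X = X}) (restrict-∩-⊆Cls {X = X}) noComplement (Y⊆Z , Y≉Z)
    where
      noComplement : ∀ C → IsRelDiff N a w X (restrict a w X ∩ F) C → ¬ N a w X C
      noComplement C rd n = noNbhd C n λ u t →
        let x , s , ¬y = proj₁ (rd u) t in
        from T-not λ f → ¬y (from T-∧ (∈-restrict⁺ {X = X} x s , f))
      Y⊆Z : (restrict a w X ∩ F) ⊆ (restrict a w X ∩ H)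
      Y⊆Z u t = let r , f = to T-∧ t in from T-∧ (r , F⊆H u f)
      Y≉Z : ¬ ((restrict a w X ∩ F) ≐ (restrict a w X ∩ H))
      Y≉Z eq = ¬f (proj₂ (to T-∧ (subst T (sym (eq v)) v∈Z)))
        where v∈Z = from T-∧ (∈-restrict⁺ {X = X} x s , h)

  N-cong : ∀ {a w X X′ Y} → (∀ v → Sim N a w v → X v ≡ X′ v) → N a w X Y → N a w X′ Y
  N-cong agree = proj₁ (ec agree _)

module Soundness (em : ExcludedMiddle 0ℓ) {P Ag W : Set} (V : P → Subset W)
                 {N : NbhdFn Ag W} (isCN : IsCN N) where

  open IsCN isCN
  open NeighbourhoodProperties em isCN
  open Semantics em {Ag = Ag} V

  ⟦_⟧ : Form P Ag → Subset W
  ⟦_⟧ = sat N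

  infix 2 _⊩_
  _⊩_ : W → Form P Ag → Set
  w ⊩ φ = w ∈ ⟦ φ ⟧

  Believes : Ag → W → Subset W → Subset W → Set
  Believes a w X Z = Σ (Subset W) λ Y → N a w X Y × (Y ⊆ Z)

  ⊩-B : ∀ {a w φ ψ} → (w ⊩ B a φ ψ) ⇔ Believes a w ⟦ φ ⟧ ⟦ ψ ⟧
  ⊩-B {a} {w} {φ} {ψ} = T-does (em {Believes a w ⟦ φ ⟧ ⟦ ψ ⟧})

  B-Sim-invariant : ∀ {a w v φ ψ} → Sim N a w v → ⟦ B a φ ψ ⟧ w ≡ ⟦ B a φ ψ ⟧ v
  B-Sim-invariant {φ = φ} s = does-⇔
    (mk⇔ (λ (Y , n , Y⊆) → Y , proj₁ (s ⟦ φ ⟧ Y) n , Y⊆)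
         (λ (Y , n , Y⊆) → Y , proj₂ (s ⟦ φ ⟧ Y) n , Y⊆))
    em em

  ⊩-K : ∀ {a w φ} → (w ⊩ K a φ) ⇔ (∀ v → Sim N a w v → v ⊩ φ)
  ⊩-K {a} {w} {φ} = mk⇔ everywhere nowhereRefuted
    where
      everywhere : w ⊩ K a φ → ∀ v → Sim N a w v → v ⊩ φ
      everywhere h v s = decidable-stable (T? _) λ ¬φ →
        to T-not h (from (⊩-B {φ = ¬' φ} {⊤'})
          (restrict a w ⟦ ¬' φ ⟧ , restrict-∈-N s (from T-not ¬φ) , λ _ _ → tt))
      nowhereRefuted : (∀ v → Sim N a w v → v ⊩ φ) → w ⊩ K a φ
      nowhereRefuted h = from T-not λ b →
        let _ , n , _ = to (⊩-B {φ = ¬' φ} {⊤'}) b ; v , s , ¬φ = N-domain-inhabited n in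
        to T-not ¬φ (h v s)

  K̂-witness : ∀ {a w φ} → w ⊩ K̂ a φ → Σ W λ v → Sim N a w v × (v ⊩ φ)
  K̂-witness {a} {w} {φ} h with em {Σ W λ v → Sim N a w v × (v ⊩ φ)}
  ... | yes witness = witness
  ... | no ¬witness = ⊥-elim (to T-not h (from (⊩-K {φ = ¬' φ}) λ v s →
                        from T-not λ φv → ¬witness (v , s , φv)))

  -- θ defines the cell of w in the partition of W into ⟦ φ ⟧ and its complement.
  B-update : ∀ {a w φ ψ χ θ} → (∀ v → ⟦ θ ⟧ v ≡ does (⟦ φ ⟧ w ≟ᵇ ⟦ φ ⟧ v)) →
             ⟦ [± φ ] B a ψ χ ⟧ w ≡ ⟦ B a (θ ∧' [± φ ] ψ) ([± φ ] χ) ⟧ w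
  B-update {a} {w} {φ} {ψ} {χ} {θ} θ-cell = does-⇔
    (mk⇔ (λ (Y , n , Y⊆) → Y , N-cong agree n , Y⊆)
         (λ (Y , n , Y⊆) → Y , N-cong (λ v s → sym (agree v s)) n , Y⊆))
    em em
    where
      open ≡-Reasoning
      agree : ∀ v → Sim N a w v →
              ⟦ [± φ ] ψ ⟧ v ∧ (does (em {Sim N a w v}) ∧ does (⟦ φ ⟧ w ≟ᵇ ⟦ φ ⟧ v))
              ≡ ⟦ θ ∧' [± φ ] ψ ⟧ v
      agree v s = begin
        ⟦ [± φ ] ψ ⟧ v ∧ (does em ∧ does (⟦ φ ⟧ w ≟ᵇ ⟦ φ ⟧ v))
          ≡⟨ cong (λ b → ⟦ [± φ ] ψ ⟧ v ∧ (b ∧ does (⟦ φ ⟧ w ≟ᵇ ⟦ φ ⟧ v))) (dec-true em s) ⟩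
        ⟦ [± φ ] ψ ⟧ v ∧ does (⟦ φ ⟧ w ≟ᵇ ⟦ φ ⟧ v)
          ≡⟨ ∧-comm (⟦ [± φ ] ψ ⟧ v) _ ⟩
        does (⟦ φ ⟧ w ≟ᵇ ⟦ φ ⟧ v) ∧ ⟦ [± φ ] ψ ⟧ v
          ≡⟨ cong (_∧ ⟦ [± φ ] ψ ⟧ v) (sym (θ-cell v)) ⟩
        ⟦ θ ∧' [± φ ] ψ ⟧ v ∎

  beval-sat : ∀ w φ → beval (λ ψ → ⟦ ψ ⟧ w) φ ≡ ⟦ φ ⟧ w
  beval-sat w ⊤'         = refl
  beval-sat w (var p)    = refl
  beval-sat w (¬' φ)     = cong not (beval-sat w φ)
  beval-sat w (φ ∧' ψ)   = cong₂ _∧_ (beval-sat w φ) (beval-sat w ψ)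
  beval-sat w (B a φ ψ)  = refl
  beval-sat w ([± φ ] ψ) = refl

  ⊩-D : ∀ {a φ ψ} w → w ⊩ B a φ ψ ⇒ ¬' B a φ (¬' ψ)
  ⊩-D {a} {φ} {ψ} w = from T-⇒ λ h → from T-not λ h′ →
    let _ , n , Y⊆ψ = to (⊩-B {φ = φ} {ψ}) h
        _ , n′ , Y′⊆¬ψ = to (⊩-B {φ = φ} {¬' ψ}) h′
    in N-intersecting n n′ λ v y y′ → to T-not (Y′⊆¬ψ v y′) (Y⊆ψ v y)

  ⊩-SC : ∀ {a φ ψ χ} w →
         w ⊩ ((¬' B a χ (¬' φ)) ∧' K̂ a (χ ∧' ((¬' φ) ∧' ψ))) ⇒ B a χ (φ ∨' ψ)
  ⊩-SC {a} {φ} {ψ} {χ} w = from T-⇒ λ h →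
    let ¬B¬φ , K̂χ¬φψ = to T-∧ h
        v , s , χ¬φψ = K̂-witness {φ = χ ∧' ((¬' φ) ∧' ψ)} K̂χ¬φψ
        χv , ¬φψ = to T-∧ χ¬φψ
        ¬φv , ψv = to T-∧ ¬φψ
        noNbhd : ∀ Y → N a w ⟦ χ ⟧ Y → ¬ (Y ⊆ ∁ ⟦ φ ⟧)
        noNbhd Y n Y⊆¬φ = to T-not ¬B¬φ (from (⊩-B {φ = χ} {¬' φ}) (Y , n , Y⊆¬φ))
    in from (⊩-B {φ = χ} {φ ∨' ψ})
         ( restrict a w ⟦ χ ⟧ ∩ ⟦ φ ∨' ψ ⟧
         , restrict-∩-∈-N noNbhd s χv (to T-not ¬φv) (T-∨⁺ (inj₂ ψv)) (λ _ → T-∨⁺ ∘ inj₁)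
         , λ _ → proj₂ ∘ to T-∧ )

  sound : ∀ {φ} → ⊢ φ → ∀ w → w ⊩ φ
  sound {φ} (taut t) w = from T-≡ (trans (sym (beval-sat w φ)) (t (λ ψ → ⟦ ψ ⟧ w)))
  sound (distK {a} {φ} {ψ}) w = from T-⇒ λ hφ⇒ψ → from T-⇒ λ hφ →
    from (⊩-K {φ = ψ}) λ v s →
      to T-⇒ (to (⊩-K {φ = φ ⇒ ψ}) hφ⇒ψ v s) (to (⊩-K {φ = φ}) hφ v s)
  sound (axT {a} {φ}) w = from T-⇒ λ h → to (⊩-K {φ = φ}) h w Sim-refl
  sound (ax5B {a} {φ} {ψ}) w = from T-⇒ λ h →
    from (⊩-K {φ = B a φ ψ}) λ v s → subst T (B-Sim-invariant {φ = φ} {ψ} s) h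
  sound (ax4B {a} {φ} {ψ}) w = from T-⇒ λ h →
    from (⊩-K {φ = ¬' B a φ ψ}) λ v s → subst (T ∘ not) (B-Sim-invariant {φ = φ} {ψ} s) h
  sound (axD {a} {φ} {ψ}) = ⊩-D {a} {φ} {ψ}
  sound (axEC {a} {φ} {ψ} {χ}) w = from T-⇒ λ h → from T-⇒ λ hb →
    let Y , n , Y⊆χ = to (⊩-B {φ = φ} {χ}) hb in
    from (⊩-B {φ = ψ} {χ}) (Y , N-cong (λ v s → to T-⇔ (to (⊩-K {φ = φ ⇔' ψ}) h v s)) n , Y⊆χ)
  sound (axM {a} {φ} {ψ} {χ}) w = from T-⇒ λ h → from T-⇒ λ hb →
    let Y , n , Y⊆φ = to (⊩-B {φ = χ} {φ}) hb in
    from (⊩-B {φ = χ} {ψ})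
      (Y , n , λ v y → to T-⇒ (to (⊩-K {φ = φ ⇒ ψ}) h v (proj₂ (c n v y))) (Y⊆φ v y))
  sound (axC {a} {φ} {ψ}) w = from T-⇒ λ hb →
    let Y , n , Y⊆ψ = to (⊩-B {φ = φ} {ψ}) hb in
    from (⊩-B {φ = φ} {φ ∧' ψ}) (Y , n , λ v y → from T-∧ (proj₁ (c n v y) , Y⊆ψ v y))
  sound (axSC {a} {φ} {ψ} {χ}) = ⊩-SC {a} {φ} {ψ} {χ}
  sound (redP {φ} {p}) w = from (T-⇔ {⟦ var p ⟧ w}) refl
  sound (redNeg {φ} {ψ}) w = from (T-⇔ {⟦ [± φ ] (¬' ψ) ⟧ w}) refl
  sound (redAnd {φ} {ψ} {χ}) w = from (T-⇔ {⟦ [± φ ] (ψ ∧' χ) ⟧ w}) refl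
  sound (redB {a} {φ} {ψ} {χ}) w = from T-⇔ (≡-by-cases (⟦ φ ⟧ w) _ _ _
    (λ φw → B-update {a} {w} {φ} {ψ} {χ} {φ} (≟-from-true φw ∘ ⟦ φ ⟧))
    (λ ¬φw → B-update {a} {w} {φ} {ψ} {χ} {¬' φ} (≟-from-false ¬φw ∘ ⟦ φ ⟧)))
  sound (mp ⊢φ⇒ψ ⊢φ) w = to T-⇒ (sound ⊢φ⇒ψ w) (sound ⊢φ w)
  sound (nec {a} {φ} ⊢φ) w = from (⊩-K {φ = φ}) λ v _ → sound ⊢φ v

theorem8 : (em : ExcludedMiddle 0ℓ) (P : Set) (k : ℕ) (φ : Form P (Fin k)) →
           ⊢ φ → (M : CNModel P (Fin k)) (w : CNModel.W M) → M , w ⊨⟨ em ⟩ φ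
theorem8 em P k φ ⊢φ M w = to T-≡ (Soundness.sound em V isCN ⊢φ w)
  where open CNModel M
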